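{- For every $j\ge 0$, let $P_{j+1}$ be the directed path with vertices $v_1,\dots,v_{j+1}$ and arcs $(v_1,v_2),\dots,(v_j,v_{j+1})$, and let $T_j(X)=T_{P_{j+1},v_1}(X)$. Then $T_j(X)=L_j(-X)$, where $L_j$ is the $j$-th Laguerre polynomial.
   Context: For a finite simple digraph $\mathfrak G=(V,A)$ with $|V|=n$, a disposition is a bijection $f:V\to\{1,\dots,n\}$ with $f(v_1)>f(v_2)$ whenever $(v_1,v_2)\in A$, and $\sigma(\mathfrak G)$ is the number of dispositions. For $v\in V$ and $i\ge0$, $\mathfrak G_i$ is obtained from $\mathfrak G$ by adding new vertices $z_1,\dots,z_i$ and arcs $(z_0,z_1),\dots,(z_{i-1},z_i)$ with $z_0=v$. The companion polynomial $T_{\mathfrak G,v}(X)$ is the (polynomial) power series satisfying $\sum_{i\ge0}\sigma(\mathfrak G_i)X^i/i!=T_{\mathfrak G,v}(X)\exp(X)$. The Laguerre polynomial is $L_j(X)=\sum_{k=0}^{j}\binom{j}{k}\frac{(-1)^k}{k!}X^k$. -}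

module Defs where

open import Data.Bool using (Bool; true; false; _∧_; _∨_; not)
open import Data.Nat using (ℕ; zero; suc; _∸_; _<ᵇ_; _≡ᵇ_; _!; _≤ᵇ_)
open import Data.Nat.Properties using (_!≢0)
open import Data.Nat.Combinatorics using (_C_)
open import Data.Fin using (Fin; zero; suc; toℕ; splitAt; _↑ˡ_; _↑ʳ_)
open import Data.Fin.Properties using (_≟_)
open import Data.Sum using (inj₁; inj₂)
open import Data.Bool.ListAction using (all; any)
open import Data.List using (List; []; _∷_; [_]; map; concatMap; length; filterᵇ; allFin; upTo; foldr)
open import Data.Integer using (ℤ; +_; -_)
open import Data.Rational using (ℚ; _/_; _+_; _*_; 0ℚ)
open import Relation.Nullary.Decidable using (⌊_⌋)
open import Relation.Binary.PropositionalEquality using (_≡_)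

-- Finite simple digraphs on the vertex set Fin n.
-- The arc set is given by a Boolean predicate; simplicity = no loops
-- (multiple arcs are impossible for a relation).

record Digraph (n : ℕ) : Set where
  field
    arc      : Fin n → Fin n → Bool
    loopless : ∀ v → arc v v ≡ false
open Digraph public

-- Dispositions.  A disposition is a bijection f : V → {1,…,n} with
-- f v₁ > f v₂ for every arc (v₁,v₂).  We use {0,…,n-1} = Fin n as the
-- target (an order-preserving relabelling of {1,…,n}).

allFuns : (n m : ℕ) → List (Fin n → Fin m)
allFuns zero    m = [ (λ ()) ]
allFuns (suc n) m = concatMap (λ f → map (λ a → cons a f) (allFin m)) (allFuns n m)
  where
  cons : Fin m → (Fin n → Fin m) → Fin (suc n) → Fin m
  cons a f zero    = a
  cons a f (suc x) = f x

isInjective : ∀ {n m} → (Fin n → Fin m) → Bool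
isInjective {n} f =
  all (λ x → all (λ y → ⌊ x ≟ y ⌋ ∨ not ⌊ f x ≟ f y ⌋) (allFin n)) (allFin n)

isSurjective : ∀ {n m} → (Fin n → Fin m) → Bool
isSurjective {n} {m} f = all (λ b → any (λ x → ⌊ f x ≟ b ⌋) (allFin n)) (allFin m)

respectsArcs : ∀ {n} → Digraph n → (Fin n → Fin n) → Bool
respectsArcs {n} G f =
  all (λ u → all (λ v → not (arc G u v) ∨ (toℕ (f v) <ᵇ toℕ (f u))) (allFin n)) (allFin n)

isDisposition : ∀ {n} → Digraph n → (Fin n → Fin n) → Bool
isDisposition G f = isInjective f ∧ isSurjective f ∧ respectsArcs G f

σ : ∀ {n} → Digraph n → ℕ
σ {n} G = length (filterᵇ (isDisposition G) (allFuns n n))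

-- The digraph G_i : add z₁,…,zᵢ and arcs (z₀,z₁),…,(z_{i-1},zᵢ), z₀ = v.
-- Vertices of G_i are Fin (n + i): the first n are the old vertices
-- (x ↑ˡ i), and z_{a+1} is  n ↑ʳ a  for a : Fin i.

extArc : ∀ {n} → Digraph n → Fin n → (i : ℕ) → Fin (n Data.Nat.+ i) → Fin (n Data.Nat.+ i) → Bool
extArc {n} G v i x y with splitAt n x | splitAt n y
... | inj₁ x' | inj₁ y' = arc G x' y'
... | inj₁ x' | inj₂ b  = ⌊ x' ≟ v ⌋ ∧ (toℕ b ≡ᵇ 0)
... | inj₂ a  | inj₁ _  = false
... | inj₂ a  | inj₂ b  = suc (toℕ a) ≡ᵇ toℕ b

private
  ≡ᵇ-suc-false : ∀ k → (suc k ≡ᵇ k) ≡ false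
  ≡ᵇ-suc-false zero    = Relation.Binary.PropositionalEquality.refl
  ≡ᵇ-suc-false (suc k) = ≡ᵇ-suc-false k

extArc-loopless : ∀ {n} (G : Digraph n) (v : Fin n) (i : ℕ) x → extArc G v i x x ≡ false
extArc-loopless {n} G v i x with splitAt n x
... | inj₁ x' = loopless G x'
... | inj₂ a  = ≡ᵇ-suc-false (toℕ a)

extend : ∀ {n} → Digraph n → Fin n → (i : ℕ) → Digraph (n Data.Nat.+ i)
extend G v i = record { arc = extArc G v i ; loopless = extArc-loopless G v i }

-- Formal power series with rational coefficients: ℕ → ℚ (coefficient of X^k).

Series : Set
Series = ℕ → ℚ

inv! : ℕ → ℚ
inv! k = (+ 1 / (k !)) {{k !≢0}}

sgn : ℕ → ℚ
sgn zero    = Data.Rational.1ℚ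
sgn (suc k) = Data.Rational.-_ (sgn k)

expSeries : Series
expSeries = inv!

_⊛_ : Series → Series → Series
(a ⊛ b) m = foldr _+_ 0ℚ (map (λ k → a k * b (m ∸ k)) (upTo (suc m)))

dispSeries : ∀ {n} → Digraph n → Fin n → Series
dispSeries G v i = (+ σ (extend G v i) / (i !)) {{i !≢0}}

IsCompanion : ∀ {n} → Digraph n → Fin n → Series → Set
IsCompanion G v T = ∀ i → dispSeries G v i ≡ (T ⊛ expSeries) i

laguerre : ℕ → Series
laguerre j k with k ≤ᵇ j
... | true  = sgn k * ((+ (j C k) / (k !)) {{k !≢0}})
... | false = 0ℚ

negArg : Series → Series
negArg P k = sgn k * P k

-- Directed path P_{j+1}: vertices v₁,…,v_{j+1} (= Fin (suc j), vₖ ↦ k-1),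
-- arcs (vₖ, v_{k+1}).

pathArc : ∀ {m} → Fin m → Fin m → Bool
pathArc u w = suc (toℕ u) ≡ᵇ toℕ w

path : (m : ℕ) → Digraph m
path m = record { arc = pathArc ; loopless = λ x → ≡ᵇ-suc-false (toℕ x) }

{-# OPTIONS --safe #-}
-- Numbered by position, the extended path (P_{j+1})ᵢ is the fork on 0, …, j + i whose root 0
-- starts the two chains 0 → 1 → ⋯ → j and 0 → j+1 → ⋯ → j+i. In a disposition the vertex with
-- the least label is a sink, and deleting it leaves a disposition of the remaining digraph. The
-- sinks of the fork are the ends of its chains, so its dispositions satisfy Pascal's recurrence
-- and number C(j+i, j). By Vandermonde's identity Σₖ C(j,k) C(i,k) = C(j+i, j), the coefficient
-- of Xⁱ in L_j(-X) exp X is C(j+i, j)/i! as well, and since exp X has constant term 1 the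
-- companion series T is determined by T exp X.
module Submission where

open import Defs

import Algebra.Properties.CommutativeSemigroup as CommutativeSemigroupProperties
import Algebra.Properties.Group as GroupProperties
open import Data.Bool using (Bool; true; false; T; not; _∨_)
open import Data.Bool.ListAction using (all; any)
open import Data.Bool.Properties using (T-∧; T?)
open import Data.Fin as Fin using (Fin; zero; suc; toℕ; punchIn; punchOut; splitAt)
import Data.Fin.Properties as Fin
open import Data.Integer as ℤ using (+_)
import Data.Integer.Properties as ℤ
open import Data.Integer.Solver using () renaming (module +-*-Solver to ℤ-Solver)
open import Data.List using (List; []; _∷_; map; concatMap; length; filter; allFin; foldr; applyUpTo)
open import Data.List.Membership.Propositional.Properties using (∈-allFin)
import Data.List.Membership.Setoid as SetoidMembership
import Data.List.Membership.Setoid.Properties as SetoidMembershipₚ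
open import Data.List.Properties using (length-map; length-removeAt′; filter-≐; map-upTo)
open import Data.List.Relation.Unary.All as All using (All; []; _∷_)
import Data.List.Relation.Unary.All.Properties as All
open import Data.List.Relation.Unary.AllPairs as AllPairs using (AllPairs; []; _∷_)
import Data.List.Relation.Unary.AllPairs.Properties as AllPairs
open import Data.List.Relation.Unary.Any as Any using (Any; here; there; _─_)
import Data.List.Relation.Unary.Any.Properties as Any
import Data.List.Relation.Unary.Unique.Setoid as SetoidUnique
open import Data.Nat as ℕ using (ℕ; zero; suc; _+_; _*_; _∸_; _!; _≤_; _<_; z≤n; s≤s; NonZero; _≤ᵇ_)
open import Data.Nat.Combinatorics
  using (_C_; nCn≡1; nCk+nC[k+1]≡[n+1]C[k+1]; k>n⇒nCk≡0; nCk≡nC[n∸k]; k![n∸k]!∣n!)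
open import Data.Nat.Combinatorics.Specification using (nCk≡n!/k![n-k]!)
open import Data.Nat.DivMod using (m*[n/m]≡n)
open import Data.Nat.Induction using (<-rec)
open import Data.Nat.ListAction using (sum)
import Data.Nat.Properties as ℕ
open import Data.Nat.Solver using () renaming (module +-*-Solver to ℕ-Solver)
open import Data.Product using (_×_; _,_; proj₁; ∃)
open import Data.Product.Function.NonDependent.Propositional using (_×-⇔_)
open import Data.Rational as ℚ using (ℚ; 0ℚ; 1ℚ; _/_)
import Data.Rational.Properties as ℚ
open import Data.Rational.Solver using () renaming (module +-*-Solver to ℚ-Solver)
open import Data.Rational.Unnormalised as ℚᵘ using (mkℚᵘ; *≡*)
import Data.Rational.Unnormalised.Properties as ℚᵘ
open import Data.Sum using (_⊎_; inj₁; inj₂)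
open import Data.Unit using (tt)
open import Data.Vec.Functional using (insertAt) renaming (_∷_ to _◂_)
open import Data.Vec.Functional.Properties using (insertAt-lookup; insertAt-punchIn)
open import Function using (_∘_)
open import Function.Bundles using (_⇔_; mk⇔; Equivalence)
open import Function.Construct.Composition using (_⇔-∘_)
open import Function.Construct.Symmetry using (⇔-sym)
open import Level using (Level)
open import Relation.Binary using (Setoid)
open import Relation.Binary.Definitions using (_Respects_)
open import Relation.Binary.PropositionalEquality
  using (_≡_; _≢_; refl; sym; trans; cong; cong₂; subst; subst₂; _≗_; _→-setoid_; module ≡-Reasoning)
open import Relation.Nullary using (¬_; contradiction; Dec; yes; no)
open import Relation.Nullary.Decidable
  using (⌊_⌋; toWitness; fromWitness; map′; _×-dec_; _⊎-dec_; ¬?; dec-false; isYes≗does; decidable-stable)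
open import Relation.Unary using (Pred; Decidable; _≐_)
open import Relation.Unary.Properties using (_∩?_; ∁?)

open Equivalence using (to; from)
open ≡-Reasoning
open CommutativeSemigroupProperties ℕ.+-commutativeSemigroup using (interchange; x∙yz≈y∙xz)
open GroupProperties ℚ.+-0-group using (∙-cancelˡ)

private
  variable
    ℓ : Level
    n m n′ m′ : ℕ

-- Counting functions up to pointwise equality

module _ {c ℓ} (S : Setoid c ℓ) where
  open Setoid S using (_≈_) renaming (trans to ≈-trans; sym to ≈-sym)
  open SetoidMembership S using (_∈_)
  open SetoidUnique S using (Unique)

  private
    ∈-─ : ∀ {x y ys} (x∈ys : x ∈ ys) → y ∈ ys → ¬ x ≈ y → y ∈ (ys ─ x∈ys)
    ∈-─ (here x≈z) (here y≈z) x≉y = contradiction (≈-trans x≈z (≈-sym y≈z)) x≉y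
    ∈-─ (here _)   (there y∈) _   = y∈
    ∈-─ (there _)  (here y≈z) _   = here y≈z
    ∈-─ (there x∈) (there y∈) x≉y = there (∈-─ x∈ y∈ x≉y)

  unique⊆⇒length≤ : ∀ {xs ys} → Unique xs → All (_∈ ys) xs → length xs ≤ length ys
  unique⊆⇒length≤ [] [] = z≤n
  unique⊆⇒length≤ {ys = ys} (x≉xs ∷ xs!) (x∈ys ∷ xs⊆ys) = ℕ.≤-trans
    (s≤s (unique⊆⇒length≤ xs! (All.zipWith (λ (x≉y , y∈ys) → ∈-─ x∈ys y∈ys x≉y) (x≉xs , xs⊆ys))))
    (ℕ.≤-reflexive (sym (length-removeAt′ ys (Any.index x∈ys))))

Functions : ℕ → ℕ → Setoid _ _
Functions n m = Fin n →-setoid Fin m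

-- allFuns extends functions by a value at 0 through a cons local to Defs; the lemmas below hold for
-- any cons agreeing with _◂_ and are applied to that one, which Agda infers.
module _ (cons : Fin m → (Fin n → Fin m) → Fin (suc n) → Fin m)
         (cons-≗ : ∀ a f → cons a f ≗ a ◂ f) where

  extensions : List (Fin n → Fin m) → List (Fin (suc n) → Fin m)
  extensions = concatMap (λ f → map (λ a → cons a f) (allFin m))

  extensions-complete : ∀ {fs} (g : Fin (suc n) → Fin m) →
    Any ((g ∘ suc) ≗_) fs → Any (g ≗_) (extensions fs)
  extensions-complete g = Any.concat⁺ ∘ Any.map⁺ ∘ Any.map λ {f} g∘suc≗f →
    Any.map⁺ (Any.map (λ { refl → λ { zero    → sym (cons-≗ _ f zero)
                                    ; (suc x) → trans (g∘suc≗f x) (sym (cons-≗ _ f (suc x))) } })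
                      (∈-allFin (g zero)))

  extensions-unique : ∀ {fs} → SetoidUnique.Unique (Functions n m) fs →
    SetoidUnique.Unique (Functions (suc n) m) (extensions fs)
  extensions-unique fs! =
    AllPairs.concat⁺ (All.map⁺ (All.universal sameBase _)) (AllPairs.map⁺ (AllPairs.map differentBases fs!))
    where
    sameBase : ∀ f → AllPairs (λ g h → ¬ g ≗ h) (map (λ a → cons a f) (allFin m))
    sameBase f = AllPairs.map⁺ (AllPairs.tabulate⁺ λ a≢b eq →
      a≢b (trans (sym (cons-≗ _ f zero)) (trans (eq zero) (cons-≗ _ f zero))))
    differentBases : ∀ {f f′} → ¬ f ≗ f′ →
      All (λ g → All (λ h → ¬ g ≗ h) (map (λ b → cons b f′) (allFin m))) (map (λ a → cons a f) (allFin m))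
    differentBases {f} {f′} f≉f′ = All.map⁺ (All.universal (λ a → All.map⁺ (All.universal (λ b eq →
      f≉f′ λ x → trans (sym (cons-≗ a f (suc x))) (trans (eq (suc x)) (cons-≗ b f′ (suc x)))) _)) _)

allFuns-complete : ∀ n m (g : Fin n → Fin m) → Any (g ≗_) (allFuns n m)
allFuns-complete zero    m g = here λ ()
allFuns-complete (suc n) m g =
  extensions-complete _ (λ { a f zero → refl ; a f (suc x) → refl }) g (allFuns-complete n m (g ∘ suc))

allFuns-unique : ∀ n m → SetoidUnique.Unique (Functions n m) (allFuns n m)
allFuns-unique zero    m = [] ∷ []
allFuns-unique (suc n) m =
  extensions-unique _ (λ { a f zero → refl ; a f (suc x) → refl }) (allFuns-unique n m)

count : {P : Pred (Fin n → Fin m) ℓ} → Decidable P → ℕ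
count {n} {m} P? = length (filter P? (allFuns n m))

module _ {a ℓ₁ ℓ₂} {A : Set a} {P : Pred A ℓ₁} {Q : Pred A ℓ₂} (P? : Decidable P) (Q? : Decidable Q) where

  length-filter-split : ∀ xs →
    length (filter P? xs) ≡ length (filter (P? ∩? Q?) xs) + length (filter (P? ∩? ∁? Q?) xs)
  length-filter-split []       = refl
  length-filter-split (x ∷ xs) with P? x | Q? x
  ... | yes _ | yes _ = cong suc (length-filter-split xs)
  ... | yes _ | no _  = trans (cong suc (length-filter-split xs)) (sym (ℕ.+-suc _ _))
  ... | no _  | _     = length-filter-split xs

module _ {ℓ₁ ℓ₂} {P : Pred (Fin n → Fin m) ℓ₁} {Q : Pred (Fin n → Fin m) ℓ₂}
         (P? : Decidable P) (Q? : Decidable Q) where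

  count-cong : P ≐ Q → count P? ≡ count Q?
  count-cong P≐Q = cong length (filter-≐ P? Q? P≐Q (allFuns n m))

  count-split : count P? ≡ count (P? ∩? Q?) + count (P? ∩? ∁? Q?)
  count-split = length-filter-split P? Q? (allFuns n m)

module _ {ℓ₁ ℓ₂} {P : Pred (Fin n → Fin m) ℓ₁} {Q : Pred (Fin n′ → Fin m′) ℓ₂}
         (P? : Decidable P) (Q? : Decidable Q) where

  injection⇒count≤ : (φ : (Fin n → Fin m) → (Fin n′ → Fin m′)) → Q Respects _≗_ →
    (∀ {f} → P f → Q (φ f)) → (∀ {f g} → P f → P g → φ f ≗ φ g → f ≗ g) →
    count P? ≤ count Q?
  injection⇒count≤ φ Q-resp φ-maps φ-injective = ℕ.≤-trans (ℕ.≤-reflexive (sym (length-map φ Ps)))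
    (unique⊆⇒length≤ (Functions n′ m′) (AllPairs.map⁺ φPs-unique) (All.map⁺ (All.map φ∈Qs Ps-in-P)))
    where
    Ps : List (Fin n → Fin m)
    Ps = filter P? (allFuns n m)
    Ps-in-P : All P Ps
    Ps-in-P = All.all-filter P? (allFuns n m)
    φPs-unique : AllPairs (λ f g → ¬ φ f ≗ φ g) Ps
    φPs-unique = restrict Ps-in-P (AllPairs.filter⁺ P? (allFuns-unique n m))
      where
      restrict : ∀ {fs} → All P fs → AllPairs (λ f g → ¬ f ≗ g) fs → AllPairs (λ f g → ¬ φ f ≗ φ g) fs
      restrict []         []           = []
      restrict (pf ∷ pfs) (f≉fs ∷ fs!) =
        All.zipWith (λ (pg , f≉g) → f≉g ∘ φ-injective pf pg) (pfs , f≉fs) ∷ restrict pfs fs!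
    φ∈Qs : ∀ {f} → P f → SetoidMembership._∈_ (Functions n′ m′) (φ f) (filter Q? (allFuns n′ m′))
    φ∈Qs pf = SetoidMembershipₚ.∈-filter⁺ (Functions n′ m′) Q? Q-resp (allFuns-complete n′ m′ _) (φ-maps pf)

module _ {ℓ₁ ℓ₂} {P : Pred (Fin n → Fin m) ℓ₁} {Q : Pred (Fin n′ → Fin m′) ℓ₂}
         (P? : Decidable P) (Q? : Decidable Q) where

  bijection⇒count≡ : (φ : (Fin n → Fin m) → (Fin n′ → Fin m′)) →
    (ψ : (Fin n′ → Fin m′) → (Fin n → Fin m)) → P Respects _≗_ → Q Respects _≗_ →
    (∀ {f g} → f ≗ g → φ f ≗ φ g) → (∀ {f g} → f ≗ g → ψ f ≗ ψ g) →
    (∀ {f} → P f → Q (φ f)) → (∀ {g} → Q g → P (ψ g)) →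
    (∀ {f} → P f → ψ (φ f) ≗ f) → (∀ {g} → Q g → φ (ψ g) ≗ g) →
    count P? ≡ count Q?
  bijection⇒count≡ φ ψ P-resp Q-resp φ-cong ψ-cong φ-maps ψ-maps ψ∘φ φ∘ψ = ℕ.≤-antisym
    (injection⇒count≤ P? Q? φ Q-resp φ-maps λ pf pf′ eq x →
      trans (sym (ψ∘φ pf x)) (trans (ψ-cong eq x) (ψ∘φ pf′ x)))
    (injection⇒count≤ Q? P? ψ P-resp ψ-maps λ qg qg′ eq x →
      trans (sym (φ∘ψ qg x)) (trans (φ-cong eq x) (φ∘ψ qg′ x)))

-- Dispositions

T-allFin : ∀ {p : Fin n → Bool} → T (all p (allFin n)) ⇔ (∀ x → T (p x))
T-allFin {n} {p} = mk⇔ (λ t x → All.lookup (All.all⁺ p (allFin n) t) (∈-allFin x))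
                       (λ h → All.all⁻ p (All.universal h (allFin n)))

T-anyFin : ∀ {p : Fin n → Bool} → T (any p (allFin n)) ⇔ ∃ (T ∘ p)
T-anyFin {n} {p} = mk⇔ (Any.satisfied ∘ Any.any⁻ p (allFin n))
                       (λ (x , px) → Any.any⁺ p (Any.map (λ { refl → px }) (∈-allFin x)))

T-not-∨ : ∀ {a b} → T (not a ∨ b) ⇔ (T a → T b)
T-not-∨ {false} = mk⇔ (λ _ ()) (λ _ → tt)
T-not-∨ {true}  = mk⇔ (λ b _ → b) (λ h → h tt)

T-⌊⌋-∨-not : ∀ {a b} {A : Set a} {B : Set b} (a? : Dec A) (b? : Dec B) →
  T (⌊ a? ⌋ ∨ not ⌊ b? ⌋) ⇔ (B → A)
T-⌊⌋-∨-not (yes a) _       = mk⇔ (λ _ _ → a) (λ _ → tt)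
T-⌊⌋-∨-not (no ¬a) (yes b) = mk⇔ (λ ()) (λ h → ¬a (h b))
T-⌊⌋-∨-not (no ¬a) (no ¬b) = mk⇔ (λ _ b → contradiction b ¬b) (λ _ → tt)

record Disposition (G : Digraph n) (f : Fin n → Fin n) : Set where
  field
    injective  : ∀ {x y} → f x ≡ f y → x ≡ y
    surjective : ∀ b → ∃ λ x → f x ≡ b
    decreasing : ∀ {u v} → T (arc G u v) → f v Fin.< f u
open Disposition

module _ {f : Fin n → Fin m} where

  isInjective⇔ : T (isInjective f) ⇔ (∀ {x y} → f x ≡ f y → x ≡ y)
  isInjective⇔ = mk⇔ injective′ λ inj →
    from (T-allFin {n}) λ x → from (T-allFin {n}) λ y → from (T-⌊⌋-∨-not (x Fin.≟ y) (f x Fin.≟ f y)) inj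
    where
    injective′ : T (isInjective f) → ∀ {x y} → f x ≡ f y → x ≡ y
    injective′ t {x} {y} = to (T-⌊⌋-∨-not (x Fin.≟ y) (f x Fin.≟ f y)) (to T-allFin (to T-allFin t x) y)

  isSurjective⇔ : T (isSurjective f) ⇔ (∀ b → ∃ λ x → f x ≡ b)
  isSurjective⇔ = mk⇔
    (λ t b → let x , fx≡b = to T-anyFin (to T-allFin t b) in x , toWitness fx≡b)
    (λ surj → from (T-allFin {m}) λ b → let x , fx≡b = surj b in from T-anyFin (x , fromWitness fx≡b))

module _ {G : Digraph n} {f : Fin n → Fin n} where

  respectsArcs⇔ : T (respectsArcs G f) ⇔ (∀ {u v} → T (arc G u v) → f v Fin.< f u)
  respectsArcs⇔ = mk⇔ decreasing′
    λ dec → from (T-allFin {n}) λ u → from (T-allFin {n}) λ v → from T-not-∨ (ℕ.<⇒<ᵇ ∘ dec)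
    where
    decreasing′ : T (respectsArcs G f) → ∀ {u v} → T (arc G u v) → f v Fin.< f u
    decreasing′ t {u} {v} = ℕ.<ᵇ⇒< _ _ ∘ to T-not-∨ (to T-allFin (to T-allFin t u) v)

  isDisposition⇔ : T (isDisposition G f) ⇔ Disposition G f
  isDisposition⇔ = mk⇔
    (λ t → let i , sr = to T-∧ t ; s , r = to T-∧ sr in record
      { injective = to isInjective⇔ i ; surjective = to isSurjective⇔ s ; decreasing = to respectsArcs⇔ r })
    (λ d → from T-∧ (from isInjective⇔ (injective d) ,
                     from T-∧ (from isSurjective⇔ (surjective d) , from respectsArcs⇔ (decreasing d))))

Disposition-resp-≗ : {G : Digraph n} → Disposition G Respects _≗_
Disposition-resp-≗ f≗g d = record
  { injective  = λ gx≡gy → injective d (trans (f≗g _) (trans gx≡gy (sym (f≗g _))))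
  ; surjective = λ b → let x , fx≡b = surjective d b in x , trans (sym (f≗g x)) fx≡b
  ; decreasing = λ {u} {v} a → subst₂ Fin._<_ (f≗g v) (f≗g u) (decreasing d a)
  }

isDisposition-resp-≗ : {G : Digraph n} → (T ∘ isDisposition G) Respects _≗_
isDisposition-resp-≗ {G = G} f≗g =
  from (isDisposition⇔ {G = G}) ∘ Disposition-resp-≗ f≗g ∘ to (isDisposition⇔ {G = G})

σ-cong : {G G′ : Digraph n} → (∀ u v → T (arc G u v) ⇔ T (arc G′ u v)) → σ G ≡ σ G′
σ-cong {n} {G} {G′} G⇔G′ = count-cong _ _
  ((λ {f} → transfer {G} {G′} (from (G⇔G′ _ _)) {f}) , λ {f} → transfer {G′} {G} (to (G⇔G′ _ _)) {f})
  where
  transfer : ∀ {H H′ : Digraph n} → (∀ {u v} → T (arc H′ u v) → T (arc H u v)) →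
    ∀ {f} → T (isDisposition H f) → T (isDisposition H′ f)
  transfer {H} {H′} H′⇒H {f} t = let d = to (isDisposition⇔ {G = H}) t in from (isDisposition⇔ {G = H′} {f = f})
    record { injective = injective d ; surjective = surjective d ; decreasing = decreasing d ∘ H′⇒H }

-- Removing the vertex with the least label

data PunchInView (s : Fin (suc n)) : Fin (suc n) → Set where
  at        : PunchInView s s
  punchedIn : ∀ x → PunchInView s (punchIn s x)

punchInView : ∀ (s y : Fin (suc n)) → PunchInView s y
punchInView s y with s Fin.≟ y
... | yes refl = at
... | no s≢y   = subst (PunchInView s) (Fin.punchIn-punchOut s≢y) (punchedIn (punchOut s≢y))

≗-byPunchIn : ∀ {a} {A : Set a} (s : Fin (suc n)) {h h′ : Fin (suc n) → A} →
  h s ≡ h′ s → (∀ x → h (punchIn s x) ≡ h′ (punchIn s x)) → h ≗ h′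
≗-byPunchIn s hs≡h′s h∘punchIn≗ y with punchInView s y
... | at          = hs≡h′s
... | punchedIn x = h∘punchIn≗ x

IsSink : Digraph n → Fin n → Set
IsSink G s = ∀ y → ¬ T (arc G s y)

minimum-isSink : {G : Digraph (suc n)} {f : Fin (suc n) → Fin (suc n)} → Disposition G f →
  ∀ {s} → f s ≡ zero → IsSink G s
minimum-isSink {f = f} d fs≡0 y a = ℕ.n≮0 (subst (λ z → f y Fin.< z) fs≡0 (decreasing d a))

σAtMin : Digraph (suc n) → Fin (suc n) → ℕ
σAtMin G s = count ((T? ∘ isDisposition G) ∩? λ f → f s Fin.≟ zero)

module _ {G : Digraph (suc n)} where

  private
    minimumAtSink : ∀ {f} → Disposition G f → ∃ λ x → IsSink G x × f x ≡ zero
    minimumAtSink d = let x , fx≡0 = surjective d zero in x , minimum-isSink d fx≡0 , fx≡0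

  σ≡σAtMin : ∀ {s} → (∀ {x} → IsSink G x → x ≡ s) → σ G ≡ σAtMin G s
  σ≡σAtMin onlySink = count-cong _ _ ((λ {f} t → t , minAt (to (isDisposition⇔ {G = G} {f = f}) t)) , proj₁)
    where
    minAt : ∀ {f} → Disposition G f → f _ ≡ zero
    minAt d with minimumAtSink d
    ... | x , x-sink , fx≡0 with onlySink x-sink
    ...   | refl = fx≡0

  σ≡σAtMin+σAtMin : ∀ {s t} → s ≢ t → (∀ {x} → IsSink G x → x ≡ s ⊎ x ≡ t) →
    σ G ≡ σAtMin G s + σAtMin G t
  σ≡σAtMin+σAtMin {s} {t} s≢t onlySinks = trans (count-split _ (λ f → f s Fin.≟ zero))
    (cong (σAtMin G s ℕ.+_) (count-cong _ _ ((λ {f} → notAt-s⇒at-t {f}) , λ {f} → at-t⇒notAt-s {f})))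
    where
    notAt-s⇒at-t : ∀ {f} → T (isDisposition G f) × f s ≢ zero → T (isDisposition G f) × f t ≡ zero
    notAt-s⇒at-t {f} (d , fs≢0) with minimumAtSink (to (isDisposition⇔ {G = G} {f = f}) d)
    ... | x , x-sink , fx≡0 with onlySinks x-sink
    ...   | inj₁ refl = contradiction fx≡0 fs≢0
    ...   | inj₂ refl = d , fx≡0
    at-t⇒notAt-s : ∀ {f} → T (isDisposition G f) × f t ≡ zero → T (isDisposition G f) × f s ≢ zero
    at-t⇒notAt-s {f} (d , ft≡0) =
      d , λ fs≡0 → s≢t (injective (to (isDisposition⇔ {G = G} {f = f}) d) (trans fs≡0 (sym ft≡0)))

module _ {G : Digraph (suc n)} {s : Fin (suc n)} {G′ : Digraph n}
         (arcs : ∀ x y → T (arc G′ x y) ⇔ T (arc G (punchIn s x) (punchIn s y)))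
         (s-sink : IsSink G s) where

  private
    -- The default is never used: on a disposition with f s ≡ 0 no punchIn s x has label 0.
    lowerOr : Fin n → Fin (suc n) → Fin n
    lowerOr d zero    = d
    lowerOr _ (suc i) = i

    removeSink : (Fin (suc n) → Fin (suc n)) → Fin n → Fin n
    removeSink f x = lowerOr x (f (punchIn s x))

    insertSink : (Fin n → Fin n) → Fin (suc n) → Fin (suc n)
    insertSink g = insertAt (suc ∘ g) s zero

    insertSink-at : ∀ g → insertSink g s ≡ zero
    insertSink-at g = insertAt-lookup (suc ∘ g) s zero

    insertSink-punchIn : ∀ g x → insertSink g (punchIn s x) ≡ suc (g x)
    insertSink-punchIn g = insertAt-punchIn (suc ∘ g) s zero

    module _ {f} (d : Disposition G f) (fs≡0 : f s ≡ zero) where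

      suc-removeSink : ∀ x → f (punchIn s x) ≡ suc (removeSink f x)
      suc-removeSink x with f (punchIn s x) in eq
      ... | zero  = contradiction (injective d (trans eq (sym fs≡0))) (Fin.punchInᵢ≢i s x)
      ... | suc _ = refl

      removeSink-disposition : Disposition G′ (removeSink f)
      removeSink-disposition = record
        { injective  = λ {x} {y} eq → Fin.punchIn-injective s x y
            (injective d (trans (suc-removeSink x) (trans (cong suc eq) (sym (suc-removeSink y)))))
        ; surjective = surjective′
        ; decreasing = λ {u} {v} a → ℕ.s<s⁻¹
            (subst₂ Fin._<_ (suc-removeSink v) (suc-removeSink u) (decreasing d (to (arcs u v) a)))
        }
        where
        surjective′ : ∀ b → ∃ λ x → removeSink f x ≡ b
        surjective′ b with surjective d (suc b)
        ... | y , fy≡1+b with punchInView s y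
        ...   | at          = contradiction (trans (sym fs≡0) fy≡1+b) λ ()
        ...   | punchedIn x = x , Fin.suc-injective (trans (sym (suc-removeSink x)) fy≡1+b)

      insertSink∘removeSink : insertSink (removeSink f) ≗ f
      insertSink∘removeSink = ≗-byPunchIn s (trans (insertSink-at _) (sym fs≡0))
        λ x → trans (insertSink-punchIn _ x) (sym (suc-removeSink x))

    insertSink-disposition : ∀ {g} → Disposition G′ g → Disposition G (insertSink g)
    insertSink-disposition {g} d = record
      { injective  = injective′
      ; surjective = λ { zero    → s , insertSink-at g
                       ; (suc b) → let x , gx≡b = surjective d b in
                                   punchIn s x , trans (insertSink-punchIn g x) (cong suc gx≡b) }
      ; decreasing = decreasing′
      }
      where
      at≢punchedIn : ∀ {i} → insertSink g s ≢ insertSink g (punchIn s i)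
      at≢punchedIn {i} eq = contradiction (trans (sym (insertSink-at g)) (trans eq (insertSink-punchIn g i))) λ ()
      injective′ : ∀ {x y} → insertSink g x ≡ insertSink g y → x ≡ y
      injective′ {x} {y} eq with punchInView s x | punchInView s y
      ... | at          | at          = refl
      ... | at          | punchedIn _ = contradiction eq at≢punchedIn
      ... | punchedIn _ | at          = contradiction (sym eq) at≢punchedIn
      ... | punchedIn i | punchedIn j = cong (punchIn s) (injective d (Fin.suc-injective
            (trans (sym (insertSink-punchIn g i)) (trans eq (insertSink-punchIn g j)))))
      decreasing′ : ∀ {u v} → T (arc G u v) → insertSink g v Fin.< insertSink g u
      decreasing′ {u} {v} a with punchInView s u | punchInView s v
      ... | at          | _           = contradiction a (s-sink _)
      ... | punchedIn i | at          =
            subst₂ Fin._<_ (sym (insertSink-at g)) (sym (insertSink-punchIn g i)) ℕ.z<s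
      ... | punchedIn i | punchedIn j =
            subst₂ Fin._<_ (sym (insertSink-punchIn g j)) (sym (insertSink-punchIn g i))
              (ℕ.s<s (decreasing d (from (arcs i j) a)))

  σAtMin-sink : σAtMin G s ≡ σ G′
  σAtMin-sink = bijection⇒count≡ _ _ removeSink insertSink
    (λ f≗f′ (t , fs≡0) → isDisposition-resp-≗ {G = G} f≗f′ t , trans (sym (f≗f′ s)) fs≡0)
    (isDisposition-resp-≗ {G = G′})
    (λ f≗f′ x → cong (lowerOr x) (f≗f′ (punchIn s x)))
    (λ g≗g′ → ≗-byPunchIn s (trans (insertSink-at _) (sym (insertSink-at _)))
       λ x → trans (insertSink-punchIn _ x) (trans (cong suc (g≗g′ x)) (sym (insertSink-punchIn _ x))))
    (λ (t , fs≡0) → from isDisposition⇔ (removeSink-disposition (to isDisposition⇔ t) fs≡0))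
    (λ t → from isDisposition⇔ (insertSink-disposition (to isDisposition⇔ t)) , insertSink-at _)
    (λ (t , fs≡0) → insertSink∘removeSink (to isDisposition⇔ t) fs≡0)
    (λ _ x → cong (lowerOr x) (insertSink-punchIn _ x))

-- The fork

-- Vertex 0 is the root v₁; 1, …, j are v₂, …, v_{j+1}; and j + 1, …, j + i are z₁, …, zᵢ.
data ForkArc (j a b : ℕ) : Set where
  chain  : b ≡ suc a → a ≢ j → ForkArc j a b
  branch : a ≡ 0 → b ≡ suc j → ForkArc j a b

forkArc? : ∀ j a b → Dec (ForkArc j a b)
forkArc? j a b =
  map′ fromCases toCases ((b ℕ.≟ suc a ×-dec ¬? (a ℕ.≟ j)) ⊎-dec (a ℕ.≟ 0 ×-dec b ℕ.≟ suc j))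
  where
  fromCases : (b ≡ suc a × a ≢ j) ⊎ (a ≡ 0 × b ≡ suc j) → ForkArc j a b
  fromCases (inj₁ (b≡1+a , a≢j)) = chain b≡1+a a≢j
  fromCases (inj₂ (a≡0 , b≡1+j)) = branch a≡0 b≡1+j
  toCases : ForkArc j a b → (b ≡ suc a × a ≢ j) ⊎ (a ≡ 0 × b ≡ suc j)
  toCases (chain b≡1+a a≢j)  = inj₁ (b≡1+a , a≢j)
  toCases (branch a≡0 b≡1+j) = inj₂ (a≡0 , b≡1+j)

ForkArc-irreflexive : ∀ {j a} → ¬ ForkArc j a a
ForkArc-irreflexive (chain a≡1+a _)  = ℕ.1+n≢n (sym a≡1+a)
ForkArc-irreflexive (branch refl ())

fork : ℕ → (N : ℕ) → Digraph N
fork j N = record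
  { arc      = λ x y → ⌊ forkArc? j (toℕ x) (toℕ y) ⌋
  ; loopless = λ x → let x? = forkArc? j (toℕ x) (toℕ x) in
                     trans (isYes≗does x?) (dec-false x? ForkArc-irreflexive)
  }

fork-arc⇔ : ∀ {j N} {x y : Fin N} → T (arc (fork j N) x y) ⇔ ForkArc j (toℕ x) (toℕ y)
fork-arc⇔ = mk⇔ toWitness fromWitness

module _ {j : ℕ} where

  ForkArc-below : ∀ {a b} → b ≤ j → ForkArc j a b ⇔ suc a ≡ b
  ForkArc-below b≤j = mk⇔
    (λ { (chain refl _) → refl ; (branch _ refl) → contradiction b≤j (ℕ.n≮n j) })
    (λ { refl → chain refl λ { refl → ℕ.n≮n j b≤j } })

  ForkArc-branch : ∀ {a c} → a ≤ j → ForkArc j a (suc j + c) ⇔ (a ≡ 0 × c ≡ 0)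
  ForkArc-branch {a} {c} a≤j = mk⇔
    (λ { (chain eq a≢j) →
           contradiction (ℕ.≤-antisym a≤j (subst (j ≤_) (ℕ.suc-injective eq) (ℕ.m≤m+n j c))) a≢j
       ; (branch a≡0 eq) →
           a≡0 , ℕ.+-cancelˡ-≡ (suc j) c 0 (trans eq (cong suc (sym (ℕ.+-identityʳ j)))) })
    (λ { (refl , refl) → branch refl (cong suc (ℕ.+-identityʳ j)) })

  ForkArc-back : ∀ {b c} → b ≤ j → ¬ ForkArc j (suc j + c) b
  ForkArc-back {c = c} b≤j (chain refl _) =
    ℕ.n≮n j (ℕ.≤-trans (s≤s (ℕ.≤-trans (ℕ.m≤m+n j c) (ℕ.n≤1+n _))) b≤j)
  ForkArc-back         b≤j (branch () _)

  ForkArc-beyond : ∀ {c d} → ForkArc j (suc j + c) (suc j + d) ⇔ suc c ≡ d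
  ForkArc-beyond {c} {d} = mk⇔
    (λ { (chain eq _) → ℕ.+-cancelˡ-≡ (suc j) (suc c) d (trans (ℕ.+-suc (suc j) c) (sym eq))
       ; (branch () _) })
    (λ { refl → chain (ℕ.+-suc (suc j) c) λ eq → ℕ.m≢1+m+n j (sym eq) })

≡ᵇ⇔≡ : ∀ {a b} → T (a ℕ.≡ᵇ b) ⇔ a ≡ b
≡ᵇ⇔≡ = mk⇔ (ℕ.≡ᵇ⇒≡ _ _) (ℕ.≡⇒≡ᵇ _ _)

≟zero⇔toℕ≡0 : ∀ {m} {x : Fin (suc m)} → T ⌊ x Fin.≟ zero ⌋ ⇔ toℕ x ≡ 0
≟zero⇔toℕ≡0 = mk⇔ (cong toℕ ∘ toWitness) (fromWitness ∘ Fin.toℕ-injective)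

toℕ-splitAt-inj₁ : ∀ {m k} {x : Fin (m + k)} {x′} → splitAt m x ≡ inj₁ x′ → toℕ x ≡ toℕ x′
toℕ-splitAt-inj₁ {k = k} {x′ = x′} eq = trans (cong toℕ (sym (Fin.splitAt⁻¹-↑ˡ eq))) (Fin.toℕ-↑ˡ x′ k)

toℕ-splitAt-inj₂ : ∀ {m k} {x : Fin (m + k)} {c} → splitAt m x ≡ inj₂ c → toℕ x ≡ m + toℕ c
toℕ-splitAt-inj₂ {m} {c = c} eq = trans (cong toℕ (sym (Fin.splitAt⁻¹-↑ʳ eq))) (Fin.toℕ-↑ʳ m c)

private
  relabel : ∀ {A : Set} {j a a′ b b′} → a ≡ a′ → b ≡ b′ → A ⇔ ForkArc j a′ b′ → A ⇔ ForkArc j a b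
  relabel refl refl A⇔ = A⇔

extend-path-arc⇔ : ∀ j i (x y : Fin (suc j + i)) →
  T (arc (extend (path (suc j)) zero i) x y) ⇔ ForkArc j (toℕ x) (toℕ y)
extend-path-arc⇔ j i x y with splitAt (suc j) x in x≡ | splitAt (suc j) y in y≡
... | inj₁ x′ | inj₁ y′ = relabel (toℕ-splitAt-inj₁ x≡) (toℕ-splitAt-inj₁ y≡)
  (⇔-sym (ForkArc-below (ℕ.s≤s⁻¹ (Fin.toℕ<n y′))) ⇔-∘ ≡ᵇ⇔≡)
... | inj₁ x′ | inj₂ c  = relabel (toℕ-splitAt-inj₁ x≡) (toℕ-splitAt-inj₂ y≡)
  (⇔-sym (ForkArc-branch (ℕ.s≤s⁻¹ (Fin.toℕ<n x′))) ⇔-∘ ((≟zero⇔toℕ≡0 ×-⇔ ≡ᵇ⇔≡) ⇔-∘ T-∧))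
... | inj₂ c  | inj₁ y′ = relabel (toℕ-splitAt-inj₂ x≡) (toℕ-splitAt-inj₁ y≡)
  (mk⇔ (λ ()) (ForkArc-back (ℕ.s≤s⁻¹ (Fin.toℕ<n y′))))
... | inj₂ c  | inj₂ d  = relabel (toℕ-splitAt-inj₂ x≡) (toℕ-splitAt-inj₂ y≡)
  (⇔-sym ForkArc-beyond ⇔-∘ ≡ᵇ⇔≡)

data PunchedIn (i : ℕ) : ℕ → ℕ → Set where
  below : ∀ {a} → a < i → PunchedIn i a a
  above : ∀ {a} → i ≤ a → PunchedIn i a (suc a)

PunchedIn-suc : ∀ {i a a′} → PunchedIn i a a′ → PunchedIn (suc i) (suc a) (suc a′)
PunchedIn-suc (below a<i) = below (s≤s a<i)
PunchedIn-suc (above i≤a) = above (s≤s i≤a)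

PunchedIn-below : ∀ {i a a′} → PunchedIn i a a′ → a < i → a′ ≡ a
PunchedIn-below (below _)   _   = refl
PunchedIn-below (above i≤a) a<i = contradiction i≤a (ℕ.<⇒≱ a<i)

toℕ-punchIn : ∀ (s : Fin (suc n)) x → PunchedIn (toℕ s) (toℕ x) (toℕ (punchIn s x))
toℕ-punchIn zero    x       = above z≤n
toℕ-punchIn (suc s) zero    = below (s≤s z≤n)
toℕ-punchIn (suc s) (suc x) = PunchedIn-suc (toℕ-punchIn s x)

ForkArc-punchIn : ∀ {j a a′ b b′} → PunchedIn (suc j) a a′ → PunchedIn (suc j) b b′ →
  ForkArc j a b ⇔ ForkArc (suc j) a′ b′
ForkArc-punchIn {j} pa pb = mk⇔ (to′ pa pb) (from′ pa pb)
  where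
  to′ : ∀ {a a′ b b′} → PunchedIn (suc j) a a′ → PunchedIn (suc j) b b′ →
    ForkArc j a b → ForkArc (suc j) a′ b′
  to′ (below a<)  (below _)   (chain refl _)     = chain refl λ { refl → ℕ.<-irrefl refl a< }
  to′ (below a<)  (above j<b) (chain refl a≢j)   = contradiction (ℕ.≤-antisym (ℕ.s≤s⁻¹ a<) (ℕ.s≤s⁻¹ j<b)) a≢j
  to′ (above j<a) (below b<)  (chain refl _)     = contradiction (ℕ.≤-trans j<a (ℕ.n≤1+n _)) (ℕ.<⇒≱ b<)
  to′ (above _)   (above _)   (chain refl a≢j)   = chain refl (a≢j ∘ ℕ.suc-injective)
  to′ _           (below b<)  (branch _ refl)    = contradiction b< (ℕ.<-irrefl refl)
  to′ (below _)   (above _)   (branch refl refl) = branch refl refl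
  to′ (above ())  _           (branch refl _)
  from′ : ∀ {a a′ b b′} → PunchedIn (suc j) a a′ → PunchedIn (suc j) b b′ →
    ForkArc (suc j) a′ b′ → ForkArc j a b
  from′ (below _)   (below b<)  (chain refl _)     = chain refl λ { refl → ℕ.<-irrefl refl b< }
  from′ (below a<)  (above j<b) (chain refl _)     = contradiction j<b (ℕ.<⇒≱ a<)
  from′ (above j<a) (below b<)  (chain refl _)     =
    contradiction (ℕ.≤-trans j<a (ℕ.n≤1+n _)) (ℕ.<⇒≱ (ℕ.<-trans (ℕ.n<1+n _) b<))
  from′ (above _)   (above _)   (chain refl a≢j)   = chain refl (a≢j ∘ cong suc)
  from′ _           (below b<)  (branch _ refl)    = contradiction (ℕ.<-trans (ℕ.n<1+n _) b<) (ℕ.<-irrefl refl)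
  from′ (below _)   (above _)   (branch refl refl) = branch refl refl
  from′ (above _)   _           (branch () _)

fork-sinks : ∀ {j n} {x : Fin (suc n)} → IsSink (fork j (suc n)) x → toℕ x ≡ n ⊎ (toℕ x ≡ j × j ≢ 0)
fork-sinks {j} {n} {x} x-sink with toℕ x ℕ.≟ n
... | yes x≡n = inj₁ x≡n
... | no x≢n  = inj₂ (x≡j , j≢0)
  where
  x<n : toℕ x < n
  x<n = ℕ.≤∧≢⇒< (ℕ.s≤s⁻¹ (Fin.toℕ<n x)) x≢n
  noArcToNext : ¬ ForkArc j (toℕ x) (suc (toℕ x))
  noArcToNext a = x-sink (Fin.fromℕ< (s≤s x<n))
    (from fork-arc⇔ (subst (ForkArc j (toℕ x)) (sym (Fin.toℕ-fromℕ< (s≤s x<n))) a))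
  x≡j : toℕ x ≡ j
  x≡j = decidable-stable (toℕ x ℕ.≟ j) (noArcToNext ∘ chain refl)
  j≢0 : j ≢ 0
  j≢0 j≡0 = noArcToNext (branch (trans x≡j j≡0) (cong suc x≡j))

module _ {j N : ℕ} where

  fork-last-isSink : IsSink (fork j (suc (suc N))) (Fin.fromℕ (suc N))
  fork-last-isSink y a with to fork-arc⇔ a
  ... | chain y≡ _ = ℕ.<-irrefl (trans y≡ (cong (λ (k : ℕ) → suc (suc k)) (Fin.toℕ-fromℕ N))) (Fin.toℕ<n y)
  ... | branch () _

  σAtMin-fork-last : σAtMin (fork j (suc (suc N))) (Fin.fromℕ (suc N)) ≡ σ (fork j (suc N))
  σAtMin-fork-last = σAtMin-sink {G = fork j (suc (suc N))} {G′ = fork j (suc N)} removeLast fork-last-isSink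
    where
    last : Fin (suc (suc N))
    last = Fin.fromℕ (suc N)
    unchanged : ∀ z → toℕ z ≡ toℕ (punchIn last z)
    unchanged z = sym (PunchedIn-below (toℕ-punchIn last z)
                                       (subst (toℕ z <_) (sym (Fin.toℕ-fromℕ (suc N))) (Fin.toℕ<n z)))
    removeLast : ∀ x y →
      T (arc (fork j (suc N)) x y) ⇔ T (arc (fork j (suc (suc N))) (punchIn last x) (punchIn last y))
    removeLast x y = ⇔-sym (relabel (unchanged x) (unchanged y) fork-arc⇔) ⇔-∘ fork-arc⇔

module _ {j N : ℕ} {v : Fin (suc N)} (toℕ-v : toℕ v ≡ suc j) where

  fork-branchEnd-isSink : IsSink (fork (suc j) (suc N)) v
  fork-branchEnd-isSink y a with to fork-arc⇔ a
  ... | chain _ v≢1+j = v≢1+j toℕ-v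
  ... | branch v≡0 _  = contradiction (trans (sym toℕ-v) v≡0) λ ()

  σAtMin-fork-branchEnd : σAtMin (fork (suc j) (suc N)) v ≡ σ (fork j N)
  σAtMin-fork-branchEnd =
    σAtMin-sink {G = fork (suc j) (suc N)} {G′ = fork j N} removeBranchEnd fork-branchEnd-isSink
    where
    shifted : ∀ z → PunchedIn (suc j) (toℕ z) (toℕ (punchIn v z))
    shifted z = subst (λ i → PunchedIn i (toℕ z) (toℕ (punchIn v z))) toℕ-v (toℕ-punchIn v z)
    removeBranchEnd : ∀ x y →
      T (arc (fork j N) x y) ⇔ T (arc (fork (suc j) (suc N)) (punchIn v x) (punchIn v y))
    removeBranchEnd x y = ⇔-sym fork-arc⇔ ⇔-∘ (ForkArc-punchIn (shifted x) (shifted y) ⇔-∘ fork-arc⇔)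

σ-fork : ∀ n j → j ≤ n → σ (fork j (suc n)) ≡ n C j
σ-fork zero    zero    z≤n       = refl
σ-fork (suc n) zero    z≤n       = begin
  σ (fork 0 (suc (suc n)))           ≡⟨ σ≡σAtMin {G = fork 0 (suc (suc n))} onlySink ⟩
  σAtMin (fork 0 (suc (suc n))) last ≡⟨ σAtMin-fork-last {0} {n} ⟩
  σ (fork 0 (suc n))                 ≡⟨ σ-fork n 0 z≤n ⟩
  1                                  ∎
  where
  last : Fin (suc (suc n))
  last = Fin.fromℕ (suc n)
  onlySink : ∀ {x} → IsSink (fork 0 (suc (suc n))) x → x ≡ last
  onlySink x-sink with fork-sinks x-sink
  ... | inj₁ x≡1+n     = Fin.toℕ-injective (trans x≡1+n (sym (Fin.toℕ-fromℕ (suc n))))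
  ... | inj₂ (_ , 0≢0) = contradiction refl 0≢0
σ-fork (suc n) (suc j) (s≤s j≤n) with ℕ.m≤n⇒m<n∨m≡n j≤n
... | inj₁ j<n = begin
  σ (fork (suc j) (suc (suc n)))
    ≡⟨ σ≡σAtMin+σAtMin {G = fork (suc j) (suc (suc n))} v≢last onlySinks ⟩
  σAtMin (fork (suc j) (suc (suc n))) v + σAtMin (fork (suc j) (suc (suc n))) last
    ≡⟨ cong₂ _+_ (σAtMin-fork-branchEnd {j} {suc n} toℕ-v) (σAtMin-fork-last {suc j} {n}) ⟩
  σ (fork j (suc n)) + σ (fork (suc j) (suc n))
    ≡⟨ cong₂ _+_ (σ-fork n j j≤n) (σ-fork n (suc j) j<n) ⟩
  n C j + n C suc j
    ≡⟨ nCk+nC[k+1]≡[n+1]C[k+1] n j ⟩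
  suc n C suc j ∎
  where
  v last : Fin (suc (suc n))
  v = Fin.fromℕ< (s≤s (s≤s j≤n))
  last = Fin.fromℕ (suc n)
  toℕ-v : toℕ v ≡ suc j
  toℕ-v = Fin.toℕ-fromℕ< (s≤s (s≤s j≤n))
  v≢last : v ≢ last
  v≢last v≡last =
    ℕ.<⇒≢ j<n (ℕ.suc-injective (trans (sym toℕ-v) (trans (cong toℕ v≡last) (Fin.toℕ-fromℕ (suc n)))))
  onlySinks : ∀ {x} → IsSink (fork (suc j) (suc (suc n))) x → x ≡ v ⊎ x ≡ last
  onlySinks x-sink with fork-sinks x-sink
  ... | inj₁ x≡1+n       = inj₂ (Fin.toℕ-injective (trans x≡1+n (sym (Fin.toℕ-fromℕ (suc n)))))
  ... | inj₂ (x≡1+j , _) = inj₁ (Fin.toℕ-injective (trans x≡1+j (sym toℕ-v)))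
... | inj₂ refl = begin
  σ (fork (suc n) (suc (suc n)))        ≡⟨ σ≡σAtMin {G = fork (suc n) (suc (suc n))} onlySink ⟩
  σAtMin (fork (suc n) (suc (suc n))) v ≡⟨ σAtMin-fork-branchEnd {n} {suc n} toℕ-v ⟩
  σ (fork n (suc n))                    ≡⟨ σ-fork n n ℕ.≤-refl ⟩
  n C n                                 ≡⟨ trans (nCn≡1 n) (sym (nCn≡1 (suc n))) ⟩
  suc n C suc n                         ∎
  where
  v : Fin (suc (suc n))
  v = Fin.fromℕ (suc n)
  toℕ-v : toℕ v ≡ suc n
  toℕ-v = Fin.toℕ-fromℕ (suc n)
  onlySink : ∀ {x} → IsSink (fork (suc n) (suc (suc n))) x → x ≡ v
  onlySink x-sink with fork-sinks x-sink
  ... | inj₁ x≡1+n       = Fin.toℕ-injective (trans x≡1+n (sym toℕ-v))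
  ... | inj₂ (x≡1+n , _) = Fin.toℕ-injective (trans x≡1+n (sym toℕ-v))

σ-extend-path : ∀ j i → σ (extend (path (suc j)) zero i) ≡ (j + i) C j
σ-extend-path j i = begin
  σ (extend (path (suc j)) zero i) ≡⟨ σ-cong {G = extend (path (suc j)) zero i} {G′ = fork j (suc j + i)}
                                       (λ x y → ⇔-sym fork-arc⇔ ⇔-∘ extend-path-arc⇔ j i x y) ⟩
  σ (fork j (suc (j + i)))         ≡⟨ σ-fork (j + i) j (ℕ.m≤m+n j i) ⟩
  (j + i) C j                      ∎

-- Power series

infixl 8 _/!_
_/!_ : ℕ → ℕ → ℚ
a /! k = (+ a / k !) {{k ℕ.!≢0}}

sumℚ : ℕ → (ℕ → ℚ) → ℚ
sumℚ n f = foldr ℚ._+_ 0ℚ (applyUpTo f n)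

sumℚ-last : ∀ n f → sumℚ (suc n) f ≡ sumℚ n f ℚ.+ f n
sumℚ-last zero    f = trans (ℚ.+-identityʳ (f 0)) (sym (ℚ.+-identityˡ (f 0)))
sumℚ-last (suc n) f = trans (cong (f 0 ℚ.+_) (sumℚ-last n (f ∘ suc))) (sym (ℚ.+-assoc (f 0) _ _))

sumℚ-cong : ∀ n {f g : ℕ → ℚ} → (∀ k → k < n → f k ≡ g k) → sumℚ n f ≡ sumℚ n g
sumℚ-cong zero    f≗g = refl
sumℚ-cong (suc n) f≗g = cong₂ ℚ._+_ (f≗g 0 ℕ.z<s) (sumℚ-cong n λ k k<n → f≗g (suc k) (s≤s k<n))

⊛-as-sum : ∀ (a b : Series) m → (a ⊛ b) m ≡ sumℚ (suc m) (λ k → a k ℚ.* b (m ∸ k))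
⊛-as-sum a b m = cong (foldr ℚ._+_ 0ℚ) (map-upTo (λ k → a k ℚ.* b (m ∸ k)) (suc m))

⊛-cancelʳ : ∀ {a a′ b : Series} → b 0 ≡ 1ℚ → (∀ m → (a ⊛ b) m ≡ (a′ ⊛ b) m) → ∀ k → a k ≡ a′ k
⊛-cancelʳ {a} {a′} {b} b0≡1 a⊛b≡a′⊛b = <-rec _ step
  where
  step : ∀ k → (∀ {i} → i < k → a i ≡ a′ i) → a k ≡ a′ k
  step k a≡a′-below = ∙-cancelˡ (initial a) (a k) (a′ k) (begin
    initial a ℚ.+ a k                         ≡⟨ cong (initial a ℚ.+_) (sym (lastTerm a)) ⟩
    initial a ℚ.+ a k ℚ.* b (k ∸ k)           ≡⟨ sym (sumℚ-last k _) ⟩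
    sumℚ (suc k) (λ i → a i ℚ.* b (k ∸ i))    ≡⟨ sym (⊛-as-sum a b k) ⟩
    (a ⊛ b) k                                 ≡⟨ a⊛b≡a′⊛b k ⟩
    (a′ ⊛ b) k                                ≡⟨ ⊛-as-sum a′ b k ⟩
    sumℚ (suc k) (λ i → a′ i ℚ.* b (k ∸ i))   ≡⟨ sumℚ-last k _ ⟩
    initial a′ ℚ.+ a′ k ℚ.* b (k ∸ k)         ≡⟨ cong₂ ℚ._+_ initial-a′≡initial-a (lastTerm a′) ⟩
    initial a ℚ.+ a′ k                        ∎)
    where
    initial : Series → ℚ
    initial c = sumℚ k (λ i → c i ℚ.* b (k ∸ i))
    initial-a′≡initial-a : initial a′ ≡ initial a
    initial-a′≡initial-a = sumℚ-cong k λ i i<k → cong (ℚ._* b (k ∸ i)) (sym (a≡a′-below i<k))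
    lastTerm : ∀ c → c k ℚ.* b (k ∸ k) ≡ c k
    lastTerm c =
      trans (cong (λ i → c k ℚ.* b i) (ℕ.n∸n≡0 k)) (trans (cong (c k ℚ.*_) b0≡1) (ℚ.*-identityʳ (c k)))

fromℚᵘ-homo-+ : ∀ p q → ℚ.fromℚᵘ (p ℚᵘ.+ q) ≡ ℚ.fromℚᵘ p ℚ.+ ℚ.fromℚᵘ q
fromℚᵘ-homo-+ p q = ℚ.toℚᵘ-injective (ℚᵘ.≃-trans (ℚ.toℚᵘ-fromℚᵘ (p ℚᵘ.+ q))
  (ℚᵘ.≃-trans (ℚᵘ.+-cong (ℚᵘ.≃-sym (ℚ.toℚᵘ-fromℚᵘ p)) (ℚᵘ.≃-sym (ℚ.toℚᵘ-fromℚᵘ q)))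
              (ℚᵘ.≃-sym (ℚ.toℚᵘ-homo-+ (ℚ.fromℚᵘ p) (ℚ.fromℚᵘ q)))))

fromℚᵘ-homo-* : ∀ p q → ℚ.fromℚᵘ (p ℚᵘ.* q) ≡ ℚ.fromℚᵘ p ℚ.* ℚ.fromℚᵘ q
fromℚᵘ-homo-* p q = ℚ.toℚᵘ-injective (ℚᵘ.≃-trans (ℚ.toℚᵘ-fromℚᵘ (p ℚᵘ.* q))
  (ℚᵘ.≃-trans (ℚᵘ.*-cong (ℚᵘ.≃-sym (ℚ.toℚᵘ-fromℚᵘ p)) (ℚᵘ.≃-sym (ℚ.toℚᵘ-fromℚᵘ q)))
              (ℚᵘ.≃-sym (ℚ.toℚᵘ-homo-* (ℚ.fromℚᵘ p) (ℚ.fromℚᵘ q)))))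

/-+-/ : ∀ a c d .{{_ : NonZero d}} → + a / d ℚ.+ + c / d ≡ + (a + c) / d
/-+-/ a c (suc d) = trans (sym (fromℚᵘ-homo-+ (mkℚᵘ (+ a) d) (mkℚᵘ (+ c) d)))
  (ℚ.fromℚᵘ-cong {mkℚᵘ (+ a) d ℚᵘ.+ mkℚᵘ (+ c) d} {mkℚᵘ (+ (a + c)) d} (*≡* (trans
    (solve 3 (λ x y D → (x :* D :+ y :* D) :* D := (x :+ y) :* (D :* D)) refl (+ a) (+ c) (+ suc d))
    (cong (ℤ._* (+ suc d ℤ.* + suc d)) (sym (ℤ.pos-+ a c))))))
  where open ℤ-Solver

/-*-/ : ∀ a b c d .{{_ : NonZero b}} .{{_ : NonZero d}} →
  (+ a / b) ℚ.* (+ c / d) ≡ (+ (a * c) / (b * d)) {{ℕ.m*n≢0 b d}}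
/-*-/ a (suc b) c (suc d) = trans (sym (fromℚᵘ-homo-* (mkℚᵘ (+ a) b) (mkℚᵘ (+ c) d)))
  (ℚ.fromℚᵘ-cong {mkℚᵘ (+ a) b ℚᵘ.* mkℚᵘ (+ c) d} {mkℚᵘ (+ (a * c)) (d + b * suc d)}
    (*≡* (cong₂ ℤ._*_ (sym (ℤ.pos-* a c)) (ℤ.pos-* (suc b) (suc d)))))

/-cross : ∀ a b c d .{{_ : NonZero b}} .{{_ : NonZero d}} → a * d ≡ c * b → + a / b ≡ + c / d
/-cross a (suc b) c (suc d) ad≡cb = ℚ.fromℚᵘ-cong {mkℚᵘ (+ a) b} {mkℚᵘ (+ c) d}
  (*≡* (trans (sym (ℤ.pos-* a (suc d))) (trans (cong +_ ad≡cb) (ℤ.pos-* c (suc b)))))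

sumℕ : ℕ → (ℕ → ℕ) → ℕ
sumℕ n f = sum (applyUpTo f n)

sumℕ-last : ∀ n f → sumℕ (suc n) f ≡ sumℕ n f + f n
sumℕ-last zero    f = ℕ.+-comm (f 0) 0
sumℕ-last (suc n) f = trans (cong (f 0 ℕ.+_) (sumℕ-last n (f ∘ suc))) (sym (ℕ.+-assoc (f 0) _ _))

sumℕ-cong : ∀ n {f g : ℕ → ℕ} → f ≗ g → sumℕ n f ≡ sumℕ n g
sumℕ-cong zero    f≗g = refl
sumℕ-cong (suc n) f≗g = cong₂ _+_ (f≗g 0) (sumℕ-cong n (f≗g ∘ suc))

sumℕ-+ : ∀ n f g → sumℕ n (λ k → f k + g k) ≡ sumℕ n f + sumℕ n g
sumℕ-+ zero    f g = refl
sumℕ-+ (suc n) f g =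
  trans (cong (f 0 + g 0 ℕ.+_) (sumℕ-+ n (f ∘ suc) (g ∘ suc))) (interchange (f 0) (g 0) _ _)

sumℚ-/ : ∀ n f d .{{_ : NonZero d}} → sumℚ n (λ k → + f k / d) ≡ + sumℕ n f / d
sumℚ-/ zero    f d = sym (ℚ.0/n≡0 d)
sumℚ-/ (suc n) f d = trans (cong (+ f 0 / d ℚ.+_) (sumℚ-/ n (f ∘ suc) d)) (/-+-/ (f 0) _ d)

vandermonde-shifted : ∀ j m r → sumℕ (suc m) (λ k → (j C (k + r)) * (m C k)) ≡ (j + m) C (m + r)
vandermonde-shifted j zero    r =
  trans (ℕ.+-identityʳ ((j C r) * 1)) (trans (ℕ.*-identityʳ (j C r)) (cong (_C r) (sym (ℕ.+-identityʳ j))))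
vandermonde-shifted j (suc m) r = begin
  G 0 + sumℕ (suc m) (λ k → (j C (suc k + r)) * (suc m C suc k))
    ≡⟨ cong (G 0 ℕ.+_) (trans (sumℕ-cong (suc m) pascal-split) (sumℕ-+ (suc m) H (G ∘ suc))) ⟩
  G 0 + (sumℕ (suc m) H + sumℕ (suc m) (G ∘ suc))
    ≡⟨ x∙yz≈y∙xz (G 0) (sumℕ (suc m) H) (sumℕ (suc m) (G ∘ suc)) ⟩
  sumℕ (suc m) H + sumℕ (suc (suc m)) G
    ≡⟨ cong (sumℕ (suc m) H ℕ.+_) (trans (sumℕ-last (suc m) G) (cong (sumℕ (suc m) G ℕ.+_) G-beyond)) ⟩
  sumℕ (suc m) H + (sumℕ (suc m) G + 0)
    ≡⟨ cong₂ _+_ (vandermonde-shifted j m (suc r)) (trans (ℕ.+-identityʳ _) (vandermonde-shifted j m r)) ⟩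
  (j + m) C (m + suc r) + (j + m) C (m + r)
    ≡⟨ cong (λ i → (j + m) C i + (j + m) C (m + r)) (ℕ.+-suc m r) ⟩
  (j + m) C suc (m + r) + (j + m) C (m + r)
    ≡⟨ ℕ.+-comm ((j + m) C suc (m + r)) ((j + m) C (m + r)) ⟩
  (j + m) C (m + r) + (j + m) C suc (m + r)
    ≡⟨ nCk+nC[k+1]≡[n+1]C[k+1] (j + m) (m + r) ⟩
  suc (j + m) C suc (m + r)
    ≡⟨ cong (_C suc (m + r)) (sym (ℕ.+-suc j m)) ⟩
  (j + suc m) C (suc m + r) ∎
  where
  G H : ℕ → ℕ
  G k = (j C (k + r)) * (m C k)
  H k = (j C (k + suc r)) * (m C k)
  pascal-split : ∀ k → (j C (suc k + r)) * (suc m C suc k) ≡ H k + G (suc k)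
  pascal-split k = begin
    (j C (suc k + r)) * (suc m C suc k)     ≡⟨ cong ((j C (suc k + r)) *_) (sym (nCk+nC[k+1]≡[n+1]C[k+1] m k)) ⟩
    (j C (suc k + r)) * (m C k + m C suc k) ≡⟨ ℕ.*-distribˡ-+ (j C (suc k + r)) (m C k) (m C suc k) ⟩
    (j C (suc k + r)) * (m C k) + G (suc k) ≡⟨ cong (λ i → (j C i) * (m C k) + G (suc k)) (sym (ℕ.+-suc k r)) ⟩
    H k + G (suc k)                         ∎
  G-beyond : G (suc m) ≡ 0
  G-beyond = trans (cong ((j C (suc m + r)) *_) (k>n⇒nCk≡0 (ℕ.n<1+n m))) (ℕ.*-zeroʳ (j C (suc m + r)))

vandermonde-diagonal : ∀ j m → sumℕ (suc m) (λ k → (j C k) * (m C k)) ≡ (j + m) C j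
vandermonde-diagonal j m = begin
  sumℕ (suc m) (λ k → (j C k) * (m C k))
    ≡⟨ sumℕ-cong (suc m) (λ k → cong (λ i → (j C i) * (m C k)) (sym (ℕ.+-identityʳ k))) ⟩
  sumℕ (suc m) (λ k → (j C (k + 0)) * (m C k)) ≡⟨ vandermonde-shifted j m 0 ⟩
  (j + m) C (m + 0)                            ≡⟨ cong ((j + m) C_) (ℕ.+-identityʳ m) ⟩
  (j + m) C m                                  ≡⟨ nCk≡nC[n∸k] (ℕ.m≤n+m m j) ⟩
  (j + m) C (j + m ∸ m)                        ≡⟨ cong ((j + m) C_) (ℕ.m+n∸n≡m j m) ⟩
  (j + m) C j                                  ∎

k!*[n∸k]!*nCk≡n! : ∀ {n k} → k ≤ n → k ! * (n ∸ k) ! * (n C k) ≡ n !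
k!*[n∸k]!*nCk≡n! {n} {k} k≤n = trans (cong (k ! * (n ∸ k) ! *_) (nCk≡n!/k![n-k]! k≤n))
  (m*[n/m]≡n {{k ℕ.!* (n ∸ k) !≢0}} (k![n∸k]!∣n! k≤n))

sgn-involutive : ∀ k q → sgn k ℚ.* (sgn k ℚ.* q) ≡ q
sgn-involutive zero    q = trans (ℚ.*-identityˡ _) (ℚ.*-identityˡ q)
sgn-involutive (suc k) q = trans (solve 2 (λ s q → (:- s) :* ((:- s) :* q) := s :* (s :* q)) refl (sgn k) q)
                                 (sgn-involutive k q)
  where open ℚ-Solver

-- Abstracting k ≤ᵇ j also abstracts the same test inside j C k: the right-hand side of the false
-- branch becomes + 0 / k !, and in the true branch the rewrite makes the two copies of j C k agree.
negArg-laguerre : ∀ j k → negArg (laguerre j) k ≡ (j C k) /! k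
negArg-laguerre j k with k ≤ᵇ j in k≤ᵇj
... | true rewrite k≤ᵇj = sgn-involutive k _
... | false             = trans (ℚ.*-zeroʳ (sgn k)) (sym (ℚ.0/n≡0 (k !) {{k ℕ.!≢0}}))

negArg-laguerre⊛exp : ∀ j m → (negArg (laguerre j) ⊛ expSeries) m ≡ ((j + m) C j) /! m
negArg-laguerre⊛exp j m = begin
  (negArg (laguerre j) ⊛ expSeries) m
    ≡⟨ ⊛-as-sum (negArg (laguerre j)) expSeries m ⟩
  sumℚ (suc m) (λ k → negArg (laguerre j) k ℚ.* inv! (m ∸ k))
    ≡⟨ sumℚ-cong (suc m) (λ k k<1+m → term k (ℕ.s≤s⁻¹ k<1+m)) ⟩
  sumℚ (suc m) (λ k → ((j C k) * (m C k)) /! m)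
    ≡⟨ sumℚ-/ (suc m) (λ k → (j C k) * (m C k)) (m !) {{m ℕ.!≢0}} ⟩
  sumℕ (suc m) (λ k → (j C k) * (m C k)) /! m
    ≡⟨ cong (_/! m) (vandermonde-diagonal j m) ⟩
  ((j + m) C j) /! m ∎
  where
  term : ∀ k → k ≤ m → negArg (laguerre j) k ℚ.* inv! (m ∸ k) ≡ ((j C k) * (m C k)) /! m
  term k k≤m = begin
    negArg (laguerre j) k ℚ.* inv! (m ∸ k)
      ≡⟨ cong (ℚ._* inv! (m ∸ k)) (negArg-laguerre j k) ⟩
    (j C k) /! k ℚ.* inv! (m ∸ k)
      ≡⟨ /-*-/ (j C k) (k !) 1 ((m ∸ k) !) {{k ℕ.!≢0}} {{(m ∸ k) ℕ.!≢0}} ⟩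
    (+ ((j C k) * 1) / (k ! * (m ∸ k) !)) {{k ℕ.!* (m ∸ k) !≢0}}
      ≡⟨ /-cross ((j C k) * 1) (k ! * (m ∸ k) !) ((j C k) * (m C k)) (m !)
                 {{k ℕ.!* (m ∸ k) !≢0}} {{m ℕ.!≢0}} cross ⟩
    ((j C k) * (m C k)) /! m ∎
    where
    cross : (j C k) * 1 * m ! ≡ (j C k) * (m C k) * (k ! * (m ∸ k) !)
    cross = begin
      (j C k) * 1 * m !
        ≡⟨ cong ((j C k) * 1 *_) (sym (k!*[n∸k]!*nCk≡n! k≤m)) ⟩
      (j C k) * 1 * (k ! * (m ∸ k) ! * (m C k))
        ≡⟨ solve 4 (λ c x y b → c :* con 1 :* (x :* y :* b) := c :* b :* (x :* y))
                   refl (j C k) (k !) ((m ∸ k) !) (m C k) ⟩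
      (j C k) * (m C k) * (k ! * (m ∸ k) !) ∎
      where open ℕ-Solver

mainTheorem7 : (j : ℕ) (T : Series) → IsCompanion (path (suc j)) zero T →
    ∀ k → T k ≡ negArg (laguerre j) k
mainTheorem7 j T T-companion = ⊛-cancelʳ refl λ m → begin
  (T ⊛ expSeries) m                     ≡⟨ sym (T-companion m) ⟩
  σ (extend (path (suc j)) zero m) /! m ≡⟨ cong (_/! m) (σ-extend-path j m) ⟩
  ((j + m) C j) /! m                    ≡⟨ sym (negArg-laguerre⊛exp j m) ⟩
  (negArg (laguerre j) ⊛ expSeries) m   ∎
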